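{- Let $Q$ be a strategy with complete lists, $w\in W$, and $Q',Q''\in\mathcal{Q}_w$. Suppose a man $x$ is active in both $Q'(w)$ and $Q''(w)$. Then every man who is active in $Q'(x;w)$ after $x$ is also active in $Q''(x;w)$.
   Context: There are $n$ men and $n$ women; a strategy assigns to each person a complete strict preference list over the opposite side, $Q(a)$ being the list of $a$. $\mathcal{Q}_w$ is the set of strategies obtained from $Q$ by replacing only $w$'s list by some permutation of the men; for $Q'\in\mathcal{Q}_w$, $Q'(w)$ is $w$'s list in $Q'$, and all other lists coincide with those of $Q$. The mechanism is the men-proposing Gale–Shapley algorithm (GS-M), deterministic with the single man of smallest index proposing next; its output on a strategy is the man-optimal stable matching. For a list $L$ of $w$, a man is active in $L$ if he proposes to $w$ during GS-M on the strategy in which $w$ uses $L$ and every other person uses his/her list from $Q$; he is active in $L$ after $x$ if his proposal to $w$ occurs after $x$'s proposal to $w$ in that run. $Q'(x;w)$ denotes the list obtained from $Q'(w)$ by moving $x$ to the front and keeping the other men in their $Q'(w)$ order. -}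

module Defs where

open import Data.Nat using (ℕ; zero; suc; _*_; _<ᵇ_)
open import Data.Fin using (Fin; _≟_)
open import Data.Bool using (Bool; true; false; if_then_else_; not)
open import Data.Maybe using (Maybe; just; nothing)
open import Data.Product using (_×_; _,_; ∃; ∃-syntax)
open import Data.List using (List; []; _∷_; _++_; filter; allFin)
open import Relation.Nullary using (¬?)
open import Relation.Nullary.Decidable using (⌊_⌋)
open import Relation.Binary.PropositionalEquality using (_≡_)
open import Data.List.Membership.Propositional using (_∈_)

-- A preference profile of one side: each person (Fin n) has a list over the
-- other side (Fin n); the list's head is the most preferred.
Prefs : ℕ → Set
Prefs n = Fin n → List (Fin n)

-- position of an element in a list (0-based; length if absent)
pos : ∀ {n} → Fin n → List (Fin n) → ℕ
pos x [] = zero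
pos x (y ∷ ys) = if ⌊ x ≟ y ⌋ then zero else suc (pos x ys)

nth : ∀ {A : Set} → List A → ℕ → Maybe A
nth [] _ = nothing
nth (y ∷ ys) zero = just y
nth (y ∷ ys) (suc k) = nth ys k

update : ∀ {n} {A : Set} → (Fin n → A) → Fin n → A → Fin n → A
update f i a j = if ⌊ j ≟ i ⌋ then a else f j

setList : ∀ {n} → Prefs n → Fin n → List (Fin n) → Prefs n
setList F w L = update F w L

moveFront : ∀ {n} → Fin n → List (Fin n) → List (Fin n)
moveFront x L = x ∷ filter (λ y → ¬? (y ≟ x)) L

-- State of GS-M: number of proposals made by each man so far,
-- and current (tentative) partner of each woman.
record State (n : ℕ) : Set where
  constructor st
  field
    made    : Fin n → ℕ
    partner : Fin n → Maybe (Fin n)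
open State public

initial : ∀ {n} → State n
initial = st (λ _ → zero) (λ _ → nothing)

isHeldBy : ∀ {n} → Maybe (Fin n) → Fin n → Bool
isHeldBy nothing m = false
isHeldBy (just m') m = ⌊ m' ≟ m ⌋

anyL : ∀ {A : Set} → (A → Bool) → List A → Bool
anyL p [] = false
anyL p (a ∷ as) = if p a then true else anyL p as

engaged : ∀ {n} → State n → Fin n → Bool
engaged {n} s m = anyL (λ v → isHeldBy (partner s v) m) (allFin n)

firstJust : ∀ {A B : Set} → (A → Maybe B) → List A → Maybe B
firstJust f [] = nothing
firstJust f (a ∷ as) with f a
... | just b = just b
... | nothing = firstJust f as

candidate : ∀ {n} → Prefs n → State n → Fin n → Maybe (Fin n × Fin n)
candidate M s m with engaged s m
... | true = nothing
... | false with nth (M m) (made s m)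
...   | nothing = nothing
...   | just v = just (m , v)

receive : ∀ {n} → List (Fin n) → Maybe (Fin n) → Fin n → Maybe (Fin n)
receive Lv nothing m = just m
receive Lv (just m') m = if pos m Lv <ᵇ pos m' Lv then just m else just m'

step : ∀ {n} → Prefs n → Prefs n → State n → Maybe ((Fin n × Fin n) × State n)
step {n} M F s with firstJust (candidate M s) (allFin n)
... | nothing = nothing
... | just (m , v) =
  just ((m , v) , st (update (made s) m (suc (made s m)))
                     (update (partner s) v (receive (F v) (partner s v) m)))

runFrom : ∀ {n} → ℕ → Prefs n → Prefs n → State n → List (Fin n × Fin n)
runFrom zero M F s = []
runFrom (suc k) M F s with step M F s
... | nothing = []
... | just (p , s') = p ∷ runFrom k M F s'

-- full run of GS-M (each man proposes at most n times, so n * n steps suffice)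
proposals : ∀ {n} → Prefs n → Prefs n → List (Fin n × Fin n)
proposals {n} M F = runFrom (n * n) M F initial

Active : ∀ {n} → Prefs n → Prefs n → Fin n → List (Fin n) → Fin n → Set
Active M F w L x = (x , w) ∈ proposals M (setList F w L)

ActiveAfter : ∀ {n} → Prefs n → Prefs n → Fin n → List (Fin n) → Fin n → Fin n → Set
ActiveAfter M F w L x y =
  ∃[ as ] ∃[ bs ] ∃[ cs ]
    proposals M (setList F w L) ≡ as ++ ((x , w) ∷ bs) ++ ((y , w) ∷ cs)

-- Compare two runs of GS-M whose profiles differ only in w's list, say L₁ in the first and L₂ in
-- the second. If w never ranks, in L₁ versus L₂, her final partner of the second run and another man
-- in opposite orders, then no man goes further down his list in the first run than in the second:
-- a man who ran out of room would be held at the end of the second run by a woman who, in the first,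
-- already holds a rival she prefers to him, while in the second she prefers him to that rival.
-- Hence every proposal of the first run also occurs in the second.
-- Moving x to the front of L reverses only pairs involving x, so an active x stays active; in
-- Q″(x;w) she then holds x at the end, since she ranks him first, and as x also heads Q′(x;w) the
-- comparison applies to the runs on Q′(x;w) and Q″(x;w).

module Submission where

open import Defs
open import Data.Bool using (Bool; true; false; T)
open import Data.Empty using (⊥-elim)
open import Data.Fin as Fin using (Fin; _≟_)
open import Data.List using (List; []; _∷_; filter; allFin; length)
open import Data.List.Membership.Propositional using (_∈_)
open import Data.List.Membership.Propositional.Properties using (∈-allFin; ∈-filter⁺; ∈-++⁺ʳ)
open import Data.List.Properties using (length-tabulate)
open import Data.List.Relation.Binary.Permutation.Propositional using (_↭_; ↭-sym)
open import Data.List.Relation.Binary.Permutation.Propositional.Properties using (↭-length; ∈-resp-↭)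
open import Data.List.Relation.Unary.Any using (here; there)
open import Data.Maybe using (Maybe; just; nothing)
open import Data.Maybe.Properties using (just-injective; ≡-dec)
open import Data.Nat using (ℕ; zero; suc; _≤_; _<_; z≤n; s≤s; s≤s⁻¹; _<ᵇ_; _+_; _*_)
open import Data.Nat.Properties as ℕ using
  (≤-refl; ≤-reflexive; ≤-trans; ≤-antisym; <⇒≤; <⇒≱; ≮⇒≥; <ᵇ⇒<; <⇒<ᵇ; n≤1+n; m≤n+m;
   m≤n⇒m<n∨m≡n; ≤∧≢⇒<; suc-injective; +-suc; +-identityʳ; +-mono-≤; +-mono-<-≤; +-mono-≤-<)
open import Data.Product using (_×_; _,_; ∃-syntax; proj₂)
open import Data.Sum using (_⊎_; inj₁; inj₂)
open import Relation.Nullary using (yes; no; ¬?)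
open import Relation.Binary.PropositionalEquality

pos-head : ∀ {n} {a x : Fin n} (xs : List (Fin n)) → pos a (x ∷ xs) ≤ 0 → a ≡ x
pos-head {a = a} {x} xs le with a ≟ x
... | yes a≡x = a≡x
pos-head xs () | no _

pos-injective : ∀ {n} {a b : Fin n} (xs : List (Fin n)) → a ∈ xs → pos a xs ≡ pos b xs → a ≡ b
pos-injective {a = a} {b} (x ∷ xs) a∈ eq with a ≟ x | b ≟ x
... | yes refl | yes refl = refl
pos-injective (x ∷ xs) a∈ () | yes refl | no _
pos-injective (x ∷ xs) a∈ () | no _ | yes refl
pos-injective (x ∷ xs) (here a≡x) eq | no a≢x | no _ = ⊥-elim (a≢x a≡x)
pos-injective (x ∷ xs) (there a∈) eq | no _ | no _ = pos-injective xs a∈ (suc-injective eq)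

pos-antisym : ∀ {n} {a b : Fin n} (xs : List (Fin n)) → a ∈ xs →
  pos a xs ≤ pos b xs → pos b xs ≤ pos a xs → a ≡ b
pos-antisym xs a∈ a≤b b≤a = pos-injective xs a∈ (≤-antisym a≤b b≤a)

without : ∀ {n} → Fin n → List (Fin n) → List (Fin n)
without x = filter (λ y → ¬? (y ≟ x))

∈-without : ∀ {n} {a x : Fin n} {xs : List (Fin n)} → a ≢ x → a ∈ xs → a ∈ without x xs
∈-without a≢x a∈ = ∈-filter⁺ (λ y → ¬? (y ≟ _)) a∈ a≢x

pos-without-mono : ∀ {n} {a b x : Fin n} (xs : List (Fin n)) → a ≢ x → b ≢ x →
  pos a xs ≤ pos b xs → pos a (without x xs) ≤ pos b (without x xs)
pos-without-mono [] a≢x b≢x le = ≤-refl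
pos-without-mono {x = x} (z ∷ zs) a≢x b≢x le with z ≟ x
pos-without-mono {a = a} {b} (z ∷ zs) a≢x b≢x le | yes refl with a ≟ z | b ≟ z
... | yes refl | _ = ⊥-elim (a≢x refl)
... | no _ | yes refl = ⊥-elim (b≢x refl)
... | no _ | no _ = pos-without-mono zs a≢x b≢x (s≤s⁻¹ le)
pos-without-mono {a = a} {b} (z ∷ zs) a≢x b≢x le | no _ with a ≟ z | b ≟ z
... | yes _ | _ = z≤n
... | no _ | no _ = s≤s (pos-without-mono zs a≢x b≢x (s≤s⁻¹ le))
pos-without-mono (z ∷ zs) a≢x b≢x () | no _ | no _ | yes _

pos-moveFront-self : ∀ {n} (x : Fin n) (xs : List (Fin n)) → pos x (moveFront x xs) ≡ 0
pos-moveFront-self x xs with x ≟ x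
... | yes _ = refl
... | no x≢x = ⊥-elim (x≢x refl)

pos-moveFront-other : ∀ {n} {a x : Fin n} (xs : List (Fin n)) → a ≢ x →
  pos a (moveFront x xs) ≡ suc (pos a (without x xs))
pos-moveFront-other {a = a} {x} xs a≢x with a ≟ x
... | yes a≡x = ⊥-elim (a≢x a≡x)
... | no _ = refl

moveFront-top : ∀ {n} {a x : Fin n} (xs : List (Fin n)) →
  pos a (moveFront x xs) ≤ pos x (moveFront x xs) → a ≡ x
moveFront-top {x = x} xs le = pos-head (without x xs) (≤-trans le (≤-reflexive (pos-moveFront-self x xs)))

moveFront-no-reversal : ∀ {n} {a b x : Fin n} (xs : List (Fin n)) → a ≢ x → a ∈ xs →
  pos a (moveFront x xs) ≤ pos b (moveFront x xs) → pos b xs ≤ pos a xs → a ≡ b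
moveFront-no-reversal {b = b} {x} xs a≢x a∈ a≤b b≤a with b ≟ x
... | yes refl = ⊥-elim (a≢x (pos-head (without b xs) a≤b))
... | no b≢x = pos-antisym (without x xs) (∈-without a≢x a∈)
  (s≤s⁻¹ (subst (_≤ _) (pos-moveFront-other xs a≢x) a≤b))
  (pos-without-mono xs b≢x a≢x b≤a)

↭allFin⇒∈ : ∀ {n} {xs : List (Fin n)} → xs ↭ allFin n → ∀ m → m ∈ xs
↭allFin⇒∈ xs↭ m = ∈-resp-↭ (↭-sym xs↭) (∈-allFin m)

↭allFin⇒length : ∀ {n} {xs : List (Fin n)} → xs ↭ allFin n → length xs ≡ n
↭allFin⇒length xs↭ = trans (↭-length xs↭) (length-tabulate (λ i → i))

nth-length : ∀ {A : Set} (xs : List A) k {a} → nth xs k ≡ just a → k < length xs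
nth-length (x ∷ xs) zero eq = s≤s z≤n
nth-length (x ∷ xs) (suc k) eq = s≤s (nth-length xs k eq)

update-same : ∀ {n} {A : Set} (f : Fin n → A) i a → update f i a i ≡ a
update-same f i a with i ≟ i
... | yes _ = refl
... | no i≢i = ⊥-elim (i≢i refl)

update-other : ∀ {n} {A : Set} (f : Fin n → A) i a {j} → j ≢ i → update f i a j ≡ f j
update-other f i a {j} j≢i with j ≟ i
... | yes j≡i = ⊥-elim (j≢i j≡i)
... | no _ = refl

anyL-true : ∀ {A : Set} (p : A → Bool) xs → anyL p xs ≡ true → ∃[ a ] p a ≡ true
anyL-true p (a ∷ as) eq with p a in pa
... | true = a , pa
... | false = anyL-true p as eq

anyL-false : ∀ {A : Set} (p : A → Bool) xs → anyL p xs ≡ false → ∀ {a} → a ∈ xs → p a ≡ false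
anyL-false p (b ∷ bs) eq a∈ with p b in pb
anyL-false p (b ∷ bs) () a∈ | true
anyL-false p (b ∷ bs) eq (here refl) | false = pb
anyL-false p (b ∷ bs) eq (there a∈) | false = anyL-false p bs eq a∈

isHeldBy-true : ∀ {n} (h : Maybe (Fin n)) m → isHeldBy h m ≡ true → h ≡ just m
isHeldBy-true (just m') m eq with m' ≟ m
... | yes refl = refl
isHeldBy-true (just m') m () | no _

isHeldBy-self : ∀ {n} (m : Fin n) → isHeldBy (just m) m ≡ true
isHeldBy-self m with m ≟ m
... | yes _ = refl
... | no m≢m = ⊥-elim (m≢m refl)

engaged-true : ∀ {n} (s : State n) m → engaged s m ≡ true → ∃[ v ] partner s v ≡ just m
engaged-true {n} s m eq with anyL-true (λ v → isHeldBy (partner s v) m) (allFin n) eq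
... | v , held = v , isHeldBy-true (partner s v) m held

engaged-false : ∀ {n} (s : State n) m → engaged s m ≡ false → ∀ v → partner s v ≢ just m
engaged-false {n} s m eq v held
  with trans (sym (isHeldBy-self m))
             (subst (λ h → isHeldBy h m ≡ false) held
                    (anyL-false (λ v → isHeldBy (partner s v) m) (allFin n) eq (∈-allFin v)))
... | ()

firstJust-just : ∀ {A B : Set} (f : A → Maybe B) xs {b} → firstJust f xs ≡ just b → ∃[ a ] f a ≡ just b
firstJust-just f (a ∷ as) eq with f a in fa
firstJust-just f (a ∷ as) refl | just _ = a , fa
... | nothing = firstJust-just f as eq

firstJust-nothing : ∀ {A B : Set} (f : A → Maybe B) xs → firstJust f xs ≡ nothing →
  ∀ {a} → a ∈ xs → f a ≡ nothing
firstJust-nothing f (c ∷ cs) eq a∈ with f c in fc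
firstJust-nothing f (c ∷ cs) () a∈ | just _
firstJust-nothing f (c ∷ cs) eq (here refl) | nothing = fc
firstJust-nothing f (c ∷ cs) eq (there a∈) | nothing = firstJust-nothing f cs eq a∈

candidate-just : ∀ {n} (M : Prefs n) s a {m v} → candidate M s a ≡ just (m , v) →
  a ≡ m × engaged s a ≡ false × nth (M a) (made s a) ≡ just v
candidate-just M s a eq with engaged s a
candidate-just M s a () | true
... | false with nth (M a) (made s a)
candidate-just M s a () | false | nothing
candidate-just M s a refl | false | just _ = refl , refl , refl

candidate-nothing : ∀ {n} (M : Prefs n) s a {v} → candidate M s a ≡ nothing →
  nth (M a) (made s a) ≡ just v → engaged s a ≡ true
candidate-nothing M s a eq next with engaged s a
... | true = refl
... | false with nth (M a) (made s a)
candidate-nothing M s a () next | false | just _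
candidate-nothing M s a eq () | false | nothing

afterProposal : ∀ {n} → Prefs n → State n → Fin n → Fin n → State n
afterProposal F s m v =
  st (update (made s) m (suc (made s m))) (update (partner s) v (receive (F v) (partner s v) m))

record ProposalStep {n} (M F : Prefs n) (s : State n) (m v : Fin n) (s' : State n) : Set where
  field
    free  : engaged s m ≡ false
    next  : nth (M m) (made s m) ≡ just v
    after : s' ≡ afterProposal F s m v

step-just : ∀ {n} (M F : Prefs n) s {m v s'} → step M F s ≡ just ((m , v) , s') → ProposalStep M F s m v s'
step-just {n} M F s eq with firstJust (candidate M s) (allFin n) in fj
step-just M F s () | nothing
step-just {n} M F s refl | just _ with firstJust-just (candidate M s) (allFin n) fj
... | a , ca with candidate-just M s a ca
... | refl , free , next = record { free = free ; next = next ; after = refl }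

step-nothing : ∀ {n} (M F : Prefs n) s → step M F s ≡ nothing →
  ∀ m {v} → nth (M m) (made s m) ≡ just v → ∃[ u ] partner s u ≡ just m
step-nothing {n} M F s eq m next with firstJust (candidate M s) (allFin n) in fj
step-nothing M F s () m next | just _
... | nothing = engaged-true s m
  (candidate-nothing M s m (firstJust-nothing (candidate M s) (allFin n) fj (∈-allFin m)) next)

-- The invariant of a run

record Proposed {n} (M : Prefs n) (s : State n) (m v : Fin n) : Set where
  constructor proposed
  field
    index      : ℕ
    index<made : index < made s m
    index-nth  : nth (M m) index ≡ just v

HoldsAtLeast : ∀ {n} → List (Fin n) → Maybe (Fin n) → Fin n → Set
HoldsAtLeast L h m = ∃[ m' ] h ≡ just m' × pos m' L ≤ pos m L

receive-from : ∀ {n} (L : List (Fin n)) h m {m₀} → receive L h m ≡ just m₀ → m₀ ≡ m ⊎ h ≡ just m₀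
receive-from L nothing m refl = inj₁ refl
receive-from L (just m₁) m eq with pos m L <ᵇ pos m₁ L
receive-from L (just m₁) m refl | true = inj₁ refl
receive-from L (just m₁) m refl | false = inj₂ refl

receive-holds : ∀ {n} (L : List (Fin n)) h m → HoldsAtLeast L (receive L h m) m
receive-holds L nothing m = m , refl , ≤-refl
receive-holds L (just m₁) m with pos m L <ᵇ pos m₁ L in better
... | true = m , refl , ≤-refl
... | false = m₁ , refl , ≮⇒≥ (λ m<m₁ → subst T better (<⇒<ᵇ m<m₁))

receive-keeps : ∀ {n} (L : List (Fin n)) h m₀ {m} → HoldsAtLeast L h m → HoldsAtLeast L (receive L h m₀) m
receive-keeps L .(just m₁) m₀ (m₁ , refl , m₁≤m) with pos m₀ L <ᵇ pos m₁ L in better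
... | true = m₀ , refl , ≤-trans (<⇒≤ (<ᵇ⇒< _ _ (subst T (sym better) _))) m₁≤m
... | false = m₁ , refl , m₁≤m

record Invariant {n} (M F : Prefs n) (s : State n) : Set where
  field
    held⇒proposed  : ∀ {v m} → partner s v ≡ just m → Proposed M s m v
    proposed⇒holds : ∀ {m v} → Proposed M s m v → HoldsAtLeast (F v) (partner s v) m
    made≤length    : ∀ m → made s m ≤ length (M m)

invariant-initial : ∀ {n} (M F : Prefs n) → Invariant M F initial
invariant-initial M F = record
  { held⇒proposed = λ ()
  ; proposed⇒holds = λ { (proposed _ () _) }
  ; made≤length = λ _ → z≤n
  }

Proposed-≤ : ∀ {n} {M : Prefs n} {s t : State n} {m v} → made s m ≤ made t m →
  Proposed M s m v → Proposed M t m v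
Proposed-≤ s≤t (proposed j j<s jth) = proposed j (≤-trans j<s s≤t) jth

module _ {n} (M F : Prefs n) (s : State n) (m v : Fin n) (next : nth (M m) (made s m) ≡ just v) where

  private
    s' = afterProposal F s m v

  made-after-≥ : ∀ m₀ → made s m₀ ≤ made s' m₀
  made-after-≥ m₀ with m₀ ≟ m
  ... | yes refl = n≤1+n _
  ... | no _ = ≤-refl

  proposed-after-self : Proposed M s' m v
  proposed-after-self = proposed (made s m) (≤-reflexive (sym (update-same (made s) m _))) next

  proposed-after : ∀ {m₀ v₀} → Proposed M s' m₀ v₀ → Proposed M s m₀ v₀ ⊎ (m₀ ≡ m × v₀ ≡ v)
  proposed-after {m₀} (proposed j j< jth) with m₀ ≟ m
  ... | no _ = inj₁ (proposed j j< jth)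
  ... | yes refl with m≤n⇒m<n∨m≡n (s≤s⁻¹ j<)
  ...   | inj₁ j<made = inj₁ (proposed j j<made jth)
  ...   | inj₂ refl = inj₂ (refl , just-injective (trans (sym jth) next))

  partner-after : ∀ {v₀ m₀} → partner s' v₀ ≡ just m₀ → partner s v₀ ≡ just m₀ ⊎ (v₀ ≡ v × m₀ ≡ m)
  partner-after {v₀} held with v₀ ≟ v
  ... | no _ = inj₁ held
  ... | yes refl with receive-from (F v₀) (partner s v₀) m held
  ...   | inj₁ m₀≡m = inj₂ (refl , m₀≡m)
  ...   | inj₂ held₀ = inj₁ held₀

  holds-after : ∀ {v₀ m₀} → HoldsAtLeast (F v₀) (partner s v₀) m₀ → HoldsAtLeast (F v₀) (partner s' v₀) m₀
  holds-after {v₀} holds with v₀ ≟ v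
  ... | no _ = holds
  ... | yes refl = receive-keeps (F v₀) (partner s v₀) m holds

  holds-after-self : HoldsAtLeast (F v) (partner s' v) m
  holds-after-self = subst (λ h → HoldsAtLeast (F v) h m) (sym (update-same (partner s) v _))
    (receive-holds (F v) (partner s v) m)

  invariant-after : Invariant M F s → Invariant M F s'
  invariant-after inv = record
    { held⇒proposed = λ held → case-partner (partner-after held)
    ; proposed⇒holds = λ p → case-proposed (proposed-after p)
    ; made≤length = bound
    }
    where
    open Invariant inv
    case-partner : ∀ {v₀ m₀} → partner s v₀ ≡ just m₀ ⊎ (v₀ ≡ v × m₀ ≡ m) → Proposed M s' m₀ v₀
    case-partner {m₀ = m₀} (inj₁ held) = Proposed-≤ (made-after-≥ m₀) (held⇒proposed held)
    case-partner (inj₂ (refl , refl)) = proposed-after-self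
    case-proposed : ∀ {m₀ v₀} → Proposed M s m₀ v₀ ⊎ (m₀ ≡ m × v₀ ≡ v) →
      HoldsAtLeast (F v₀) (partner s' v₀) m₀
    case-proposed (inj₁ p) = holds-after (proposed⇒holds p)
    case-proposed (inj₂ (refl , refl)) = holds-after-self
    bound : ∀ m₀ → made s' m₀ ≤ length (M m₀)
    bound m₀ with m₀ ≟ m
    ... | yes refl = nth-length (M m₀) (made s m₀) next
    ... | no _ = made≤length m₀

finalFrom : ∀ {n} → ℕ → Prefs n → Prefs n → State n → State n
finalFrom zero M F s = s
finalFrom (suc k) M F s with step M F s
... | nothing = s
... | just (_ , s') = finalFrom k M F s'

Final : ∀ {n} → Prefs n → Prefs n → State n
Final {n} M F = finalFrom (n * n) M F initial

module _ {n} (M F : Prefs n) where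

  Preserved : (State n → Set) → Set
  Preserved P = ∀ {s m v s'} → ProposalStep M F s m v s' → P s → P s'

  finalFrom-preserves : ∀ {P} → Preserved P → ∀ k s → P s → P (finalFrom k M F s)
  finalFrom-preserves pres zero s p = p
  finalFrom-preserves pres (suc k) s p with step M F s in eq
  ... | nothing = p
  ... | just (_ , s') = finalFrom-preserves pres k s' (pres (step-just M F s eq) p)

  invariant-Final : Invariant M F (Final M F)
  invariant-Final = finalFrom-preserves preserved (n * n) initial (invariant-initial M F)
    where
    preserved : Preserved (Invariant M F)
    preserved {s} {m} {v} record { next = next ; after = refl } = invariant-after M F s m v next

  made-finalFrom-≥ : ∀ k s m₀ → made s m₀ ≤ made (finalFrom k M F s) m₀
  made-finalFrom-≥ k s m₀ = finalFrom-preserves preserved k s ≤-refl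
    where
    preserved : Preserved (λ t → made s m₀ ≤ made t m₀)
    preserved {t} {m} {v} record { next = next ; after = refl } s≤t = ≤-trans s≤t (made-after-≥ M F t m v next m₀)

  runFrom⇒Proposed : ∀ k s {m₀ v₀} → (m₀ , v₀) ∈ runFrom k M F s → Proposed M (finalFrom k M F s) m₀ v₀
  runFrom⇒Proposed (suc k) s mem with step M F s in eq
  runFrom⇒Proposed (suc k) s () | nothing
  runFrom⇒Proposed (suc k) s (here refl) | just ((m , v) , s') with step-just M F s eq
  ... | record { next = next ; after = refl } =
    Proposed-≤ (made-finalFrom-≥ k s' m) (proposed-after-self M F s m v next)
  runFrom⇒Proposed (suc k) s (there mem) | just (_ , s') = runFrom⇒Proposed k s' mem

  Proposed⇒runFrom : ∀ k s {m₀ v₀} j → made s m₀ ≤ j → j < made (finalFrom k M F s) m₀ →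
    nth (M m₀) j ≡ just v₀ → (m₀ , v₀) ∈ runFrom k M F s
  Proposed⇒runFrom zero s j s≤j j<s jth = ⊥-elim (<⇒≱ j<s s≤j)
  Proposed⇒runFrom (suc k) s j s≤j j< jth with step M F s in eq
  ... | nothing = ⊥-elim (<⇒≱ j< s≤j)
  ... | just ((m , v) , s') with step-just M F s eq
  ... | record { next = next ; after = refl } with _ ≟ m
  ...   | no m₀≢m = there (Proposed⇒runFrom k s' j
          (subst (_≤ j) (sym (update-other (made s) m _ m₀≢m)) s≤j) j< jth)
  ...   | yes refl with made s m ℕ.≟ j
  ...     | no made≢j = there (Proposed⇒runFrom k s' j
            (subst (_≤ j) (sym (update-same (made s) m _)) (≤∧≢⇒< s≤j made≢j)) j< jth)
  ...     | yes refl with just-injective (trans (sym next) jth)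
  ...       | refl = here refl

  ∈-proposals⁻ : ∀ {m v} → (m , v) ∈ proposals M F → Proposed M (Final M F) m v
  ∈-proposals⁻ = runFrom⇒Proposed (n * n) initial

  ∈-proposals⁺ : ∀ {m v} → Proposed M (Final M F) m v → (m , v) ∈ proposals M F
  ∈-proposals⁺ (proposed j j< jth) = Proposed⇒runFrom (n * n) initial j z≤n j< jth

-- Termination

sumFin : ∀ k → (Fin k → ℕ) → ℕ
sumFin zero f = 0
sumFin (suc k) f = f Fin.zero + sumFin k (λ i → f (Fin.suc i))

sumFin-cong : ∀ k {f g : Fin k → ℕ} → (∀ i → f i ≡ g i) → sumFin k f ≡ sumFin k g
sumFin-cong zero f≗g = refl
sumFin-cong (suc k) f≗g = cong₂ _+_ (f≗g Fin.zero) (sumFin-cong k (λ i → f≗g (Fin.suc i)))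

sumFin-update-suc : ∀ k (f : Fin k → ℕ) i → sumFin k (update f i (suc (f i))) ≡ suc (sumFin k f)
sumFin-update-suc (suc k) f Fin.zero = cong (λ t → suc (f Fin.zero + t)) (sumFin-cong k (λ _ → refl))
sumFin-update-suc (suc k) f (Fin.suc i) = begin
  f Fin.zero + sumFin k (λ j → update f (Fin.suc i) (suc (f (Fin.suc i))) (Fin.suc j))
    ≡⟨ cong (f Fin.zero +_) (sumFin-cong k shifted) ⟩
  f Fin.zero + sumFin k (update (λ j → f (Fin.suc j)) i (suc (f (Fin.suc i))))
    ≡⟨ cong (f Fin.zero +_) (sumFin-update-suc k (λ j → f (Fin.suc j)) i) ⟩
  f Fin.zero + suc (sumFin k (λ j → f (Fin.suc j)))
    ≡⟨ +-suc _ _ ⟩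
  suc (sumFin (suc k) f) ∎
  where
  open ≡-Reasoning
  shifted : ∀ j → update f (Fin.suc i) (suc (f (Fin.suc i))) (Fin.suc j)
                ≡ update (λ j → f (Fin.suc j)) i (suc (f (Fin.suc i))) j
  shifted j with j ≟ i
  ... | yes refl = refl
  ... | no _ = refl

sumFin-≤ : ∀ k (f : Fin k → ℕ) {b} → (∀ i → f i ≤ b) → sumFin k f ≤ k * b
sumFin-≤ zero f f≤b = z≤n
sumFin-≤ (suc k) f f≤b = +-mono-≤ (f≤b Fin.zero) (sumFin-≤ k _ (λ i → f≤b (Fin.suc i)))

sumFin-< : ∀ k (f : Fin k → ℕ) {b} i → (∀ j → f j ≤ b) → f i < b → sumFin k f < k * b
sumFin-< (suc k) f Fin.zero f≤b fi<b = +-mono-<-≤ fi<b (sumFin-≤ k _ (λ j → f≤b (Fin.suc j)))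
sumFin-< (suc k) f (Fin.suc i) f≤b fi<b =
  +-mono-≤-< (f≤b Fin.zero) (sumFin-< k _ i (λ j → f≤b (Fin.suc j)) fi<b)

-- Invariant: n * n ≤ proposals made + steps left; each step makes one proposal, and at most n * n can be made.
finalFrom-terminal : ∀ {n} (M F : Prefs n) → (∀ m → length (M m) ≡ n) → ∀ k s → Invariant M F s →
  n * n ≤ sumFin n (made s) + k → step M F (finalFrom k M F s) ≡ nothing
finalFrom-terminal {n} M F lengths zero s inv total with step M F s in eq
... | nothing = refl
... | just ((m , v) , _) with step-just M F s eq
... | record { next = next } = ⊥-elim (<⇒≱
  (sumFin-< n (made s) m made≤n (subst (made s m <_) (lengths m) (nth-length (M m) _ next)))
  (subst (n * n ≤_) (+-identityʳ _) total))
  where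
  made≤n : ∀ j → made s j ≤ n
  made≤n j = subst (made s j ≤_) (lengths j) (Invariant.made≤length inv j)
finalFrom-terminal {n} M F lengths (suc k) s inv total with step M F s in eq
... | nothing = eq
... | just ((m , v) , _) with step-just M F s eq
... | record { next = next ; after = refl } =
  finalFrom-terminal M F lengths k _ (invariant-after M F s m v next inv)
    (subst (n * n ≤_) (trans (+-suc _ k) (cong (_+ k) (sym (sumFin-update-suc n (made s) m)))) total)

Final-engaged : ∀ {n} (M F : Prefs n) → (∀ m → length (M m) ≡ n) →
  ∀ m {v} → nth (M m) (made (Final M F) m) ≡ just v → ∃[ u ] partner (Final M F) u ≡ just m
Final-engaged {n} M F lengths = step-nothing M F (Final M F)
  (finalFrom-terminal M F lengths (n * n) initial (invariant-initial M F) (m≤n+m (n * n) _))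

-- Comparing runs that differ only in w's list

NoReversal : ∀ {n} → List (Fin n) → List (Fin n) → Maybe (Fin n) → Set
NoReversal L₁ L₂ h = ∀ {m m'} → h ≡ just m → pos m' L₁ ≤ pos m L₁ → pos m L₂ ≤ pos m' L₂ → m ≡ m'

module _ {n} (M F : Prefs n) (M-complete : ∀ m → M m ↭ allFin n) (F-complete : ∀ v → F v ↭ allFin n)
  (w : Fin n) (L₁ L₂ : List (Fin n))
  (no-reversal : NoReversal L₁ L₂ (partner (Final M (setList F w L₂)) w))
  where

  private
    F₁ F₂ : Prefs n
    F₁ = setList F w L₁
    F₂ = setList F w L₂
    s₂ = Final M F₂
    inv₂ = invariant-Final M F₂

    no-reversal-anywhere : ∀ v → NoReversal (F₁ v) (F₂ v) (partner s₂ v)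
    no-reversal-anywhere v {m} held m'≤m m≤m' with v ≟ w
    ... | yes refl = no-reversal held m'≤m m≤m'
    ... | no _ = pos-antisym (F v) (↭allFin⇒∈ (F-complete v) m) m≤m' m'≤m

    Bounded : State n → Set
    Bounded s = Invariant M F₁ s × (∀ m → made s m ≤ made s₂ m)

    -- Having made as many proposals as in run 2, m is held there by some v₂ he already proposed to in s;
    -- she holds in s some m' she ranks weakly above m under F₁, and in run 2 she ranks m weakly above m'.
    not-exhausted : ∀ {s m v} → Bounded s → engaged s m ≡ false → nth (M m) (made s m) ≡ just v →
      made s m ≢ made s₂ m
    not-exhausted {s} {m} (inv , made≤) free next made≡
      with Final-engaged M F₂ (λ m → ↭allFin⇒length (M-complete m)) m
             (subst (λ c → nth (M m) c ≡ just _) made≡ next)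
    ... | v₂ , held₂
      with Invariant.proposed⇒holds inv
             (Proposed-≤ (≤-reflexive (sym made≡)) (Invariant.held⇒proposed inv₂ held₂))
    ... | m' , held₁ , m'≤m
      with Invariant.proposed⇒holds inv₂
             (Proposed-≤ (made≤ m') (Invariant.held⇒proposed inv held₁))
    ... | m″ , held₂′ , m″≤m' with just-injective (trans (sym held₂) held₂′)
    ... | refl = engaged-false s m free v₂
      (subst (λ m₀ → partner s v₂ ≡ just m₀) (sym (no-reversal-anywhere v₂ held₂ m'≤m m″≤m')) held₁)

    bounded-preserved : Preserved M F₁ Bounded
    bounded-preserved {s} {m} {v} record { free = free ; next = next ; after = refl } (inv , made≤) =
      invariant-after M F₁ s m v next inv , made≤′
      where
      made≤′ : ∀ m₀ → made (afterProposal F₁ s m v) m₀ ≤ made s₂ m₀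
      made≤′ m₀ with m₀ ≟ m
      ... | no _ = made≤ m₀
      ... | yes refl with m≤n⇒m<n∨m≡n (made≤ m₀)
      ...   | inj₁ made< = made<
      ...   | inj₂ made≡ = ⊥-elim (not-exhausted (inv , made≤) free next made≡)

    made-Final-≤ : ∀ m → made (Final M F₁) m ≤ made s₂ m
    made-Final-≤ = proj₂ (finalFrom-preserves M F₁ bounded-preserved (n * n) initial
      (invariant-initial M F₁ , λ _ → z≤n))

  proposals-⊆ : ∀ {m v} → (m , v) ∈ proposals M F₁ → (m , v) ∈ proposals M F₂
  proposals-⊆ {m} p = ∈-proposals⁺ M F₂ (Proposed-≤ (made-Final-≤ m) (∈-proposals⁻ M F₁ p))

moveFront-active : ∀ {n} (M F : Prefs n) → (∀ m → M m ↭ allFin n) → (∀ v → F v ↭ allFin n) →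
  ∀ w {L} → L ↭ allFin n → ∀ {x} → Active M F w L x → Active M F w (moveFront x L) x
moveFront-active M F M-complete F-complete w {L} L-complete {x} x-active
  with ≡-dec _≟_ (partner (Final M (setList F w (moveFront x L))) w) (just x)
... | yes held = ∈-proposals⁺ M _ (Invariant.held⇒proposed (invariant-Final M _) held)
... | no not-held = proposals-⊆ M F M-complete F-complete w L (moveFront x L) no-reversal x-active
  where
  no-reversal : NoReversal L (moveFront x L) (partner (Final M (setList F w (moveFront x L))) w)
  no-reversal held m'≤m m≤m' =
    moveFront-no-reversal L (λ { refl → not-held held }) (↭allFin⇒∈ L-complete _) m≤m' m'≤m

front-held : ∀ {n} (M F : Prefs n) w L {x} → Active M F w (moveFront x L) x →
  partner (Final M (setList F w (moveFront x L))) w ≡ just x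
front-held M F w L {x} x-active
  with Invariant.proposed⇒holds (invariant-Final M _) (∈-proposals⁻ M _ x-active)
... | m , held , m≤x
  rewrite moveFront-top L (subst (λ K → pos m K ≤ pos x K) (update-same F w (moveFront x L)) m≤x)
  = held

lemma2 : ∀ {n} (M F : Prefs n)
    → (∀ m → M m ↭ allFin n) → (∀ v → F v ↭ allFin n)
    → (w : Fin n) (L′ L″ : List (Fin n)) → L′ ↭ allFin n → L″ ↭ allFin n
    → (x : Fin n) → Active M F w L′ x → Active M F w L″ x
    → ∀ y → ActiveAfter M F w (moveFront x L′) x y
    → Active M F w (moveFront x L″) y
lemma2 M F M-complete F-complete w L′ L″ _ L″-complete x _ x-active″ y (as , bs , _ , run≡) =
  proposals-⊆ M F M-complete F-complete w (moveFront x L′) (moveFront x L″) no-reversal y-active′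
  where
  y-active′ : Active M F w (moveFront x L′) y
  y-active′ = subst ((y , w) ∈_) (sym run≡) (∈-++⁺ʳ as (∈-++⁺ʳ ((x , w) ∷ bs) (here refl)))
  x-held : partner (Final M (setList F w (moveFront x L″))) w ≡ just x
  x-held = front-held M F w L″ (moveFront-active M F M-complete F-complete w L″-complete x-active″)
  no-reversal : NoReversal (moveFront x L′) (moveFront x L″) (partner (Final M (setList F w (moveFront x L″))) w)
  no-reversal held m'≤m _ with just-injective (trans (sym x-held) held)
  ... | refl = sym (moveFront-top L′ m'≤m)
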